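{- Let $G$ be a graph of treewidth at most $k$ and maximum degree at most $\Delta$. Then the total graph $T(G)$ has treewidth at most $(k+1)(\Delta+1)$.
   Context: For a graph $G=(V,E)$, the total graph $T(G)$ has vertex set $V\cup E$, and its edges are: the edges of $G$ (joining adjacent vertices), an edge between $e,f\in E$ whenever $e$ and $f$ share an endpoint in $G$, and an edge between $v\in V$ and $e\in E$ whenever $v$ is an endpoint of $e$. Treewidth is defined via tree decompositions: a tree $T$ with bags $\mathcal{D}(t)$ of vertices covering all vertices and edges, such that the nodes containing any given vertex form a connected subtree; the width is the maximum bag size minus one, and treewidth is the minimum width. -}

module Defs where

open import Data.Nat using (ℕ; suc; _≤_)
open import Data.Fin using (Fin) renaming (_<_ to _<ᶠ_)
open import Data.Bool using (Bool; T)
open import Data.Sum using (_⊎_; inj₁; inj₂)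
open import Data.Product using (Σ; _×_; _,_; ∃; ∃-syntax; proj₁; proj₂)
open import Data.Unit using (⊤)
open import Data.Empty using (⊥)
open import Data.List using (List; []; _∷_; _++_; [_]; length)
open import Data.List.Membership.Propositional using (_∈_)
open import Data.List.Relation.Unary.Unique.Propositional using (Unique)
open import Data.List.Relation.Unary.Linked using (Linked)
open import Relation.Nullary using (¬_)
open import Relation.Binary.PropositionalEquality using (_≡_; _≢_)

record SimpleGraph (n : ℕ) : Set where
  field
    adj     : Fin n → Fin n → Bool
    symm    : ∀ u v → T (adj u v) → T (adj v u)
    irrefl  : ∀ v → ¬ T (adj v v)

  Adj : Fin n → Fin n → Set
  Adj u v = T (adj u v)

  -- An edge {u,v} is represented once, as an ordered pair (u , v) with u < v.
  Edge : Set
  Edge = Σ (Fin n × Fin n) λ p → (proj₁ p <ᶠ proj₂ p) × Adj (proj₁ p) (proj₂ p)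

  _∈ₑ_ : Fin n → Edge → Set
  v ∈ₑ ((a , b) , _) = (v ≡ a) ⊎ (v ≡ b)

  ShareEnd : Edge → Edge → Set
  ShareEnd e f = ∃[ v ] (v ∈ₑ e × v ∈ₑ f)

open SimpleGraph public

MaxDegree≤ : ∀ {n} → SimpleGraph n → ℕ → Set
MaxDegree≤ {n} G Δ =
  ∀ (v : Fin n) (ns : List (Fin n)) → Unique ns →
    (∀ {u} → u ∈ ns → Adj G v u) → length ns ≤ Δ

TotalV : ∀ {n} → SimpleGraph n → Set
TotalV {n} G = Fin n ⊎ Edge G

TotalAdj : ∀ {n} (G : SimpleGraph n) → TotalV G → TotalV G → Set
TotalAdj G (inj₁ u) (inj₁ v) = Adj G u v
TotalAdj G (inj₂ e) (inj₂ f) = (e ≢ f) × ShareEnd G e f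
TotalAdj G (inj₁ v) (inj₂ e) = _∈ₑ_ G v e
TotalAdj G (inj₂ e) (inj₁ v) = _∈ₑ_ G v e

data Walk {X : Set} (R : X → X → Set) (P : X → Set) : X → X → Set where
  here : ∀ {x} → P x → Walk R P x x
  step : ∀ {x y z} → P x → R x y → Walk R P y z → Walk R P x z

record Tree (m : ℕ) : Set₁ where
  field
    TAdj      : Fin m → Fin m → Set
    tsym      : ∀ s t → TAdj s t → TAdj t s
    tirrefl   : ∀ t → ¬ TAdj t t
    connected : ∀ s t → Walk TAdj (λ _ → ⊤) s t
    acyclic   : ∀ (x y z : Fin m) (rest : List (Fin m)) →
                  Unique (x ∷ y ∷ z ∷ rest) →
                  ¬ Linked TAdj ((x ∷ y ∷ z ∷ rest) ++ [ x ])

open Tree public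

record TreeDecomposition (V : Set) (_~_ : V → V → Set) (w : ℕ) : Set₁ where
  field
    m        : ℕ
    tree     : Tree (suc m)
    bag      : Fin (suc m) → List V
    bagUniq  : ∀ t → Unique (bag t)
    bagSize  : ∀ t → length (bag t) ≤ suc w
    covV     : ∀ v → ∃[ t ] (v ∈ bag t)
    covE     : ∀ u v → u ~ v → ∃[ t ] (u ∈ bag t × v ∈ bag t)
    subtree  : ∀ v s t → v ∈ bag s → v ∈ bag t →
                 Walk (TAdj tree) (λ r → v ∈ bag r) s t

TreewidthAtMost : (V : Set) → (V → V → Set) → ℕ → Set₁
TreewidthAtMost V _~_ w = TreeDecomposition V _~_ w

Treewidth≤ : ∀ {n} → SimpleGraph n → ℕ → Set₁
Treewidth≤ {n} G w = TreewidthAtMost (Fin n) (Adj G) w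

TotalTreewidth≤ : ∀ {n} → SimpleGraph n → ℕ → Set₁
TotalTreewidth≤ G w = TreewidthAtMost (TotalV G) (TotalAdj G) w

-- Replace every bag B of a tree decomposition of G by B together with all
-- edges having an endpoint in B, over the same tree.  An edge uv then lies
-- in the bags of the union of the subtrees of u and of v, which is connected
-- because some bag contains both u and v; two edges with a common endpoint
-- w, or an edge and its endpoint w, meet in any bag of w.  Each vertex of B
-- contributes at most Δ edges, so the new bags have at most
-- (k+1) + (k+1)Δ = (k+1)(Δ+1) elements.
module Submission where

open import Defs
open import Data.Nat using (ℕ; suc; _*_; _+_; _≤_; z≤n; s≤s)
open import Data.Nat.Properties
  using (≤-refl; ≤-trans; ≤-reflexive; n≤1+n; +-suc; +-monoˡ-≤; +-monoʳ-≤; +-mono-≤; *-suc; *-monoˡ-≤; module ≤-Reasoning)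
open import Data.Fin using (Fin) renaming (_<_ to _<ᶠ_)
open import Data.Fin.Properties using (_≟_; _<?_; <-irrelevant; <-asym)
open import Data.Bool.Properties using (T?; T-irrelevant)
open import Data.Sum using (_⊎_; inj₁; inj₂)
open import Data.Sum.Properties using (inj₁-injective; inj₂-injective)
open import Data.Product using (Σ; _×_; _,_; ∃-syntax; proj₁; proj₂)
open import Data.Empty using (⊥; ⊥-elim)
open import Data.List using (List; []; _∷_; _++_; length; map; filter; cartesianProduct; allFin)
open import Data.List.Properties using (length-map; length-++; filter-accept; filter-none)
open import Data.List.Membership.Propositional using (_∈_; find; lose)
open import Data.List.Membership.Propositional.Properties
  using (∈-map⁺; ∈-map⁻; ∈-++⁺ˡ; ∈-++⁺ʳ; ∈-++⁻; ∈-filter⁺; ∈-filter⁻; ∈-cartesianProduct⁺; ∈-allFin)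
open import Data.List.Relation.Unary.Any using (Any; here; there; any?)
open import Data.List.Relation.Unary.All as All using (All; []; _∷_)
open import Data.List.Relation.Unary.All.Properties as All using (all-filter)
open import Data.List.Relation.Unary.Unique.Propositional using (Unique)
open import Data.List.Relation.Unary.AllPairs using ([]; _∷_)
import Data.List.Relation.Unary.Unique.Propositional.Properties as Unique
open import Relation.Nullary using (yes; no; Irrelevant)
open import Relation.Nullary.Decidable using (_×-dec_; _⊎-dec_)
open import Relation.Unary using (Decidable)
open import Relation.Binary.PropositionalEquality using (_≡_; refl; sym; trans; cong; cong₂; subst)

private
  variable
    X : Set
    R : X → X → Set
    P Q : X → Set

map-Walk : (∀ {x} → P x → Q x) → ∀ {x y} → Walk R P x y → Walk R Q x y
map-Walk f (here p)     = here (f p)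
map-Walk f (step p r w) = step (f p) r (map-Walk f w)

_++-Walk_ : ∀ {x y z} → Walk R P x y → Walk R P y z → Walk R P x z
here _     ++-Walk w′ = w′
step p r w ++-Walk w′ = step p r (w ++-Walk w′)

length-filter-∷ : (P? : Decidable P) (x : X) (xs : List X) →
  length (filter P? xs) ≤ length (filter P? (x ∷ xs))
length-filter-∷ P? x xs with P? x
... | yes _ = n≤1+n _
... | no  _ = ≤-refl

module _ {P Q R : X → Set} (P? : Decidable P) (Q? : Decidable Q) (R? : Decidable R)
         (P⊆Q∪R : ∀ {x} → P x → Q x ⊎ R x) where

  length-filter-⊆-⊎ : ∀ xs →
    length (filter P? xs) ≤ length (filter Q? xs) + length (filter R? xs)
  length-filter-⊆-⊎ []       = z≤n
  length-filter-⊆-⊎ (x ∷ xs) with P? x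
  ... | no _ = ≤-trans (length-filter-⊆-⊎ xs)
                       (+-mono-≤ (length-filter-∷ Q? x xs) (length-filter-∷ R? x xs))
  ... | yes px with P⊆Q∪R px
  ...   | inj₁ qx = begin
    suc (length (filter P? xs))                               ≤⟨ s≤s (length-filter-⊆-⊎ xs) ⟩
    suc (length (filter Q? xs)) + length (filter R? xs)       ≡⟨ cong (λ ys → length ys + _) (filter-accept Q? qx) ⟨
    length (filter Q? (x ∷ xs)) + length (filter R? xs)       ≤⟨ +-monoʳ-≤ _ (length-filter-∷ R? x xs) ⟩
    length (filter Q? (x ∷ xs)) + length (filter R? (x ∷ xs)) ∎
    where open ≤-Reasoning
  ...   | inj₂ rx = begin
    suc (length (filter P? xs))                               ≤⟨ s≤s (length-filter-⊆-⊎ xs) ⟩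
    suc (length (filter Q? xs) + length (filter R? xs))       ≡⟨ +-suc _ _ ⟨
    length (filter Q? xs) + suc (length (filter R? xs))       ≡⟨ cong (λ ys → _ + length ys) (filter-accept R? rx) ⟨
    length (filter Q? xs) + length (filter R? (x ∷ xs))       ≤⟨ +-monoˡ-≤ _ (length-filter-∷ Q? x xs) ⟩
    length (filter Q? (x ∷ xs)) + length (filter R? (x ∷ xs)) ∎
    where open ≤-Reasoning

map-unique-on : ∀ {B : Set} {P : X → Set} {f : X → B} →
  (∀ {x y} → P x → P y → f x ≡ f y → x ≡ y) →
  ∀ {xs} → All P xs → Unique xs → Unique (map f xs)
map-unique-on f-inj []         []           = []
map-unique-on f-inj (px ∷ pxs) (x∉xs ∷ uxs) =
  All.map⁺ (All.zipWith (λ (x≢y , py) fx≡fy → x≢y (f-inj px py fx≡fy)) (x∉xs , pxs))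
  ∷ map-unique-on f-inj pxs uxs

module _ {P : X → Set} (P? : Decidable P) (P-irrelevant : ∀ {x} → Irrelevant (P x)) where

  witnesses : List X → List (Σ X P)
  witnesses []       = []
  witnesses (x ∷ xs) with P? x
  ... | yes px = (x , px) ∷ witnesses xs
  ... | no  _  = witnesses xs

  ∈-witnesses⁺ : ∀ {xs} (w : Σ X P) → proj₁ w ∈ xs → w ∈ witnesses xs
  ∈-witnesses⁺ {x ∷ xs} w x∈ with P? x
  ∈-witnesses⁺ {x ∷ xs} (x , p) (here refl) | yes px = here (cong (x ,_) (P-irrelevant p px))
  ∈-witnesses⁺ {x ∷ xs} (x , p) (here refl) | no ¬px = ⊥-elim (¬px p)
  ∈-witnesses⁺ {x ∷ xs} w       (there w∈)  | yes _  = there (∈-witnesses⁺ w w∈)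
  ∈-witnesses⁺ {x ∷ xs} w       (there w∈)  | no  _  = ∈-witnesses⁺ w w∈

  ∈-witnesses⁻ : ∀ {xs} {w : Σ X P} → w ∈ witnesses xs → proj₁ w ∈ xs
  ∈-witnesses⁻ {x ∷ xs} w∈ with P? x
  ∈-witnesses⁻ {x ∷ xs} (here refl) | yes _ = here refl
  ∈-witnesses⁻ {x ∷ xs} (there w∈) | yes _ = there (∈-witnesses⁻ w∈)
  ∈-witnesses⁻ {x ∷ xs} w∈         | no  _ = there (∈-witnesses⁻ w∈)

  witnesses-unique : ∀ {xs} → Unique xs → Unique (witnesses xs)
  witnesses-unique {[]}     []          = []
  witnesses-unique {x ∷ xs} (x∉ ∷ uxs) with P? x
  ... | yes _ = All.tabulate (λ w∈ eq → All.lookup x∉ (∈-witnesses⁻ w∈) (cong proj₁ eq))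
                ∷ witnesses-unique uxs
  ... | no  _ = witnesses-unique uxs

module Edges {n : ℕ} (G : SimpleGraph n) where

  IsEdge : Fin n × Fin n → Set
  IsEdge (a , b) = (a <ᶠ b) × Adj G a b

  isEdge? : Decidable IsEdge
  isEdge? (a , b) = (a <? b) ×-dec T? (adj G a b)

  isEdge-irrelevant : ∀ {p} → Irrelevant (IsEdge p)
  isEdge-irrelevant (a<b , ab) (a<b′ , ab′) = cong₂ _,_ (<-irrelevant a<b a<b′) (T-irrelevant ab ab′)

  edges : List (Edge G)
  edges = witnesses isEdge? isEdge-irrelevant (cartesianProduct (allFin n) (allFin n))

  ∈-edges : ∀ e → e ∈ edges
  ∈-edges e@((a , b) , _) =
    ∈-witnesses⁺ isEdge? isEdge-irrelevant e (∈-cartesianProduct⁺ (∈-allFin a) (∈-allFin b))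

  edges-unique : Unique edges
  edges-unique = witnesses-unique isEdge? isEdge-irrelevant
    (Unique.cartesianProduct⁺ (Unique.allFin⁺ n) (Unique.allFin⁺ n))

  edge-≡ : ∀ {e f : Edge G} → proj₁ e ≡ proj₁ f → e ≡ f
  edge-≡ {p , ep} {.p , fp} refl = cong (p ,_) (isEdge-irrelevant ep fp)

  edge-ordered : ∀ (e : Edge G) {x y} → proj₁ e ≡ (x , y) → x <ᶠ y
  edge-ordered (_ , a<b , _) refl = a<b

  _∈ₑ?_ : ∀ v → Decidable (_∈ₑ_ G v)
  (v ∈ₑ? ((a , b) , _)) = (v ≟ a) ⊎-dec (v ≟ b)

  opposite : Fin n → Edge G → Fin n
  opposite v ((a , b) , _) with v ≟ a
  ... | yes _ = b
  ... | no  _ = a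

  endpoints-opposite : ∀ {v} e → _∈ₑ_ G v e →
    proj₁ e ≡ (v , opposite v e) ⊎ proj₁ e ≡ (opposite v e , v)
  endpoints-opposite {v} ((a , b) , _) v∈e with v ≟ a | v∈e
  ... | yes refl | _        = inj₁ refl
  ... | no  v≢a  | inj₁ v≡a = ⊥-elim (v≢a v≡a)
  ... | no  _    | inj₂ refl = inj₂ refl

  opposite-adjacent : ∀ {v} e → _∈ₑ_ G v e → Adj G v (opposite v e)
  opposite-adjacent {v} ((a , b) , _ , ab) v∈e with v ≟ a | v∈e
  ... | yes refl | _         = ab
  ... | no  v≢a  | inj₁ v≡a  = ⊥-elim (v≢a v≡a)
  ... | no  _    | inj₂ refl = symm G a v ab

  opposite-injective : ∀ {v} e f → _∈ₑ_ G v e → _∈ₑ_ G v f →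
    opposite v e ≡ opposite v f → e ≡ f
  opposite-injective {v} e f v∈e v∈f eq
    with endpoints-opposite e v∈e | endpoints-opposite f v∈f
  ... | inj₁ pe | inj₁ pf = edge-≡ (trans pe (trans (cong (v ,_) eq) (sym pf)))
  ... | inj₂ pe | inj₂ pf = edge-≡ (trans pe (trans (cong (_, v) eq) (sym pf)))
  ... | inj₁ pe | inj₂ pf =
    ⊥-elim (<-asym (edge-ordered e pe) (subst (_<ᶠ v) (sym eq) (edge-ordered f pf)))
  ... | inj₂ pe | inj₁ pf =
    ⊥-elim (<-asym (edge-ordered e pe) (subst (v <ᶠ_) (sym eq) (edge-ordered f pf)))

  incidentEdges : Fin n → List (Edge G)
  incidentEdges v = filter (v ∈ₑ?_) edges

  length-incidentEdges : ∀ {Δ} → MaxDegree≤ G Δ → ∀ v → length (incidentEdges v) ≤ Δ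
  length-incidentEdges deg v = subst (_≤ _) (length-map (opposite v) (incidentEdges v))
    (deg v (map (opposite v) (incidentEdges v)) neighbours-unique neighbours-adjacent)
    where
    incident : All (_∈ₑ_ G v) (incidentEdges v)
    incident = all-filter (v ∈ₑ?_) edges

    neighbours-unique : Unique (map (opposite v) (incidentEdges v))
    neighbours-unique = map-unique-on (opposite-injective _ _) incident
                                      (Unique.filter⁺ (v ∈ₑ?_) edges-unique)

    neighbours-adjacent : ∀ {u} → u ∈ map (opposite v) (incidentEdges v) → Adj G v u
    neighbours-adjacent u∈ with ∈-map⁻ (opposite v) u∈
    ... | e , e∈ , refl = opposite-adjacent e (All.lookup incident e∈)

  Meets : List (Fin n) → Edge G → Set
  Meets B e = Any (λ v → _∈ₑ_ G v e) B

  meets? : ∀ B → Decidable (Meets B)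
  meets? B e = any? (_∈ₑ? e) B

  edgesMeeting : List (Fin n) → List (Edge G)
  edgesMeeting B = filter (meets? B) edges

  length-edgesMeeting : ∀ {Δ} → MaxDegree≤ G Δ → ∀ B → length (edgesMeeting B) ≤ length B * Δ
  length-edgesMeeting deg []      = ≤-reflexive (cong length (filter-none (meets? []) {xs = edges} (All.tabulate λ _ ())))
  length-edgesMeeting deg (v ∷ B) =
    ≤-trans (length-filter-⊆-⊎ (meets? (v ∷ B)) (v ∈ₑ?_) (meets? B) (λ {e} → head-or-tail {e}) edges)
            (+-mono-≤ (length-incidentEdges deg v) (length-edgesMeeting deg B))
    where
    head-or-tail : ∀ {e} → Meets (v ∷ B) e → _∈ₑ_ G v e ⊎ Meets B e
    head-or-tail (here v∈e)  = inj₁ v∈e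
    head-or-tail (there B∩e) = inj₂ B∩e

module TotalDecomposition {n k Δ : ℕ} (G : SimpleGraph n)
  (D : TreeDecomposition (Fin n) (Adj G) k) (deg : MaxDegree≤ G Δ) where

  open TreeDecomposition D
  open Edges G

  totalBag : Fin (suc m) → List (TotalV G)
  totalBag t = map inj₁ (bag t) ++ map inj₂ (edgesMeeting (bag t))

  ∈-totalBag-vertex⁺ : ∀ {v t} → v ∈ bag t → inj₁ v ∈ totalBag t
  ∈-totalBag-vertex⁺ v∈ = ∈-++⁺ˡ (∈-map⁺ inj₁ v∈)

  ∈-totalBag-edge⁺ : ∀ {v t} e → v ∈ bag t → _∈ₑ_ G v e → inj₂ e ∈ totalBag t
  ∈-totalBag-edge⁺ {t = t} e v∈ v∈e = ∈-++⁺ʳ (map inj₁ (bag t))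
    (∈-map⁺ inj₂ (∈-filter⁺ (meets? (bag t)) (∈-edges e) (lose v∈ v∈e)))

  ∈-totalBag-vertex⁻ : ∀ {v t} → inj₁ v ∈ totalBag t → v ∈ bag t
  ∈-totalBag-vertex⁻ {t = t} v∈ with ∈-++⁻ (map inj₁ (bag t)) v∈
  ... | inj₁ v∈₁ with ∈-map⁻ inj₁ v∈₁
  ...   | _ , v∈bag , refl = v∈bag
  ∈-totalBag-vertex⁻ {t = t} v∈ | inj₂ v∈₂ with ∈-map⁻ inj₂ v∈₂
  ...   | _ , _ , ()

  ∈-totalBag-edge⁻ : ∀ {e t} → inj₂ e ∈ totalBag t → ∃[ v ] (v ∈ bag t × _∈ₑ_ G v e)
  ∈-totalBag-edge⁻ {t = t} e∈ with ∈-++⁻ (map inj₁ (bag t)) e∈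
  ... | inj₁ e∈₁ with ∈-map⁻ inj₁ e∈₁
  ...   | _ , _ , ()
  ∈-totalBag-edge⁻ {t = t} e∈ | inj₂ e∈₂ with ∈-map⁻ inj₂ e∈₂
  ...   | _ , e∈meeting , refl = find (proj₂ (∈-filter⁻ (meets? (bag t)) {xs = edges} e∈meeting))

  totalBag-unique : ∀ t → Unique (totalBag t)
  totalBag-unique t = Unique.++⁺
    (Unique.map⁺ inj₁-injective (bagUniq t))
    (Unique.map⁺ inj₂-injective (Unique.filter⁺ (meets? (bag t)) edges-unique))
    λ (x∈₁ , x∈₂) → disjoint x∈₁ x∈₂
    where
    disjoint : ∀ {x} → x ∈ map inj₁ (bag t) → x ∈ map inj₂ (edgesMeeting (bag t)) → ⊥
    disjoint x∈₁ x∈₂ with ∈-map⁻ inj₁ x∈₁ | ∈-map⁻ inj₂ x∈₂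
    ... | _ , _ , refl | _ , _ , ()

  length-totalBag : ∀ t → length (totalBag t) ≤ suc (suc k * suc Δ)
  length-totalBag t = begin
    length (totalBag t)                        ≡⟨ length-++ (map inj₁ (bag t)) ⟩
    length (map inj₁ (bag t)) + length (map inj₂ (edgesMeeting (bag t)))
      ≡⟨ cong₂ _+_ (length-map inj₁ (bag t)) (length-map inj₂ (edgesMeeting (bag t))) ⟩
    length (bag t) + length (edgesMeeting (bag t)) ≤⟨ +-monoʳ-≤ _ (length-edgesMeeting deg (bag t)) ⟩
    length (bag t) + length (bag t) * Δ        ≡⟨ *-suc (length (bag t)) Δ ⟨
    length (bag t) * suc Δ                     ≤⟨ *-monoˡ-≤ (suc Δ) (bagSize t) ⟩
    suc k * suc Δ                              ≤⟨ n≤1+n _ ⟩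
    suc (suc k * suc Δ)                        ∎
    where open ≤-Reasoning

  totalBag-covers-vertices : ∀ x → ∃[ t ] (x ∈ totalBag t)
  totalBag-covers-vertices (inj₁ v) with covV v
  ... | t , v∈ = t , ∈-totalBag-vertex⁺ v∈
  totalBag-covers-vertices (inj₂ e@((a , _) , _)) with covV a
  ... | t , a∈ = t , ∈-totalBag-edge⁺ e a∈ (inj₁ refl)

  totalBag-covers-edges : ∀ x y → TotalAdj G x y → ∃[ t ] (x ∈ totalBag t × y ∈ totalBag t)
  totalBag-covers-edges (inj₁ u) (inj₁ v) uv with covE u v uv
  ... | t , u∈ , v∈ = t , ∈-totalBag-vertex⁺ u∈ , ∈-totalBag-vertex⁺ v∈
  totalBag-covers-edges (inj₁ v) (inj₂ e) v∈e with covV v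
  ... | t , v∈ = t , ∈-totalBag-vertex⁺ v∈ , ∈-totalBag-edge⁺ e v∈ v∈e
  totalBag-covers-edges (inj₂ e) (inj₁ v) v∈e with covV v
  ... | t , v∈ = t , ∈-totalBag-edge⁺ e v∈ v∈e , ∈-totalBag-vertex⁺ v∈
  totalBag-covers-edges (inj₂ e) (inj₂ f) (_ , v , v∈e , v∈f) with covV v
  ... | t , v∈ = t , ∈-totalBag-edge⁺ e v∈ v∈e , ∈-totalBag-edge⁺ f v∈ v∈f

  totalBag-subtree : ∀ x s t → x ∈ totalBag s → x ∈ totalBag t →
    Walk (TAdj tree) (λ r → x ∈ totalBag r) s t
  totalBag-subtree (inj₁ v) s t v∈s v∈t =
    map-Walk ∈-totalBag-vertex⁺ (subtree v s t (∈-totalBag-vertex⁻ v∈s) (∈-totalBag-vertex⁻ v∈t))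
  totalBag-subtree (inj₂ e@((a , b) , _ , ab)) s t e∈s e∈t
    with ∈-totalBag-edge⁻ e∈s | ∈-totalBag-edge⁻ e∈t | covE a b ab
  ... | u , u∈s , u∈e | w , w∈t , w∈e | r , a∈r , b∈r =
    map-Walk (λ u∈ → ∈-totalBag-edge⁺ e u∈ u∈e) (subtree u s r u∈s (endpoint∈r u∈e))
    ++-Walk
    map-Walk (λ w∈ → ∈-totalBag-edge⁺ e w∈ w∈e) (subtree w r t (endpoint∈r w∈e) w∈t)
    where
    endpoint∈r : ∀ {v} → _∈ₑ_ G v e → v ∈ bag r
    endpoint∈r (inj₁ refl) = a∈r
    endpoint∈r (inj₂ refl) = b∈r

  totalDecomposition : TotalTreewidth≤ G (suc k * suc Δ)
  totalDecomposition = record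
    { m       = m
    ; tree    = tree
    ; bag     = totalBag
    ; bagUniq = totalBag-unique
    ; bagSize = length-totalBag
    ; covV    = totalBag-covers-vertices
    ; covE    = totalBag-covers-edges
    ; subtree = totalBag-subtree
    }

mainTheorem6 : ∀ (n k Δ : ℕ) (G : SimpleGraph n) →
    Treewidth≤ G k → MaxDegree≤ G Δ →
    TotalTreewidth≤ G ((suc k) * (suc Δ))
mainTheorem6 n k Δ G D deg = TotalDecomposition.totalDecomposition G D deg
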